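{- Let $G=(V,E)$ be a graph on $n$ vertices, let $b$ be a positive integer and let $k\in\{1,\dots,\lfloor n/2\rfloor\}$ be such that $\Psi_E(G,k)>b$. Then in the $(1:b)$ Maker--Breaker game on the edge set of $G$ in which Breaker moves first, Maker is able to carry out the tree strategy for at least $k$ rounds; that is, for each $j=1,\dots,k$, immediately before Maker's $j$-th move there is a free edge in $E(T,V\setminus T)$, where $T$ is Maker's current tree.
   Context: In the $(1:b)$ Maker--Breaker game on the edge set of $G$, Maker and Breaker alternately claim free (previously unclaimed) edges, Maker one per move and Breaker $b$ per move. The tree strategy of Maker: he fixes an arbitrary vertex $r$ and maintains a vertex set $T$ (initially $T=\{r\}$) spanned by a tree of his edges; in each move he claims a free edge $e\in E(T,V\setminus T)$ and adds its endpoint outside $T$ to $T$; if no such free edge exists he cannot continue. For disjoint $A,B\subseteq V$, $E(A,B)$ is the set of edges of $G$ with one endpoint in $A$ and the other in $B$. For $k=1,\dots,\lfloor n/2\rfloor$, $\Psi_E(G,k)=\min\{|E(S,V\setminus S)|/|S| : S\subseteq V,\ 1\le |S|\le k\}$. -}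

module Defs where

open import Data.Nat using (ℕ; zero; suc; _+_; _*_; _≤_; _<_)
open import Data.Bool using (Bool; true; false; _∧_; not; if_then_else_)
open import Data.Fin using (Fin)
open import Data.Fin.Subset using (Subset; ⁅_⁆; _∪_; _∈_; _∉_; ∣_∣)
open import Data.Vec using (lookup)
open import Data.List using (List; []; _∷_; _++_; length; map; allFin)
open import Data.Nat.ListAction using (sum)
open import Data.List.Relation.Unary.Any using (Any)
open import Data.List.Relation.Unary.All using (All)
open import Data.List.Relation.Unary.AllPairs using (AllPairs)
open import Data.Product using (_×_; _,_; Σ; ∃)
open import Data.Sum using (_⊎_)
open import Relation.Nullary using (¬_; Dec)
open import Relation.Nullary.Decidable using (⌊_⌋)
open import Relation.Binary.PropositionalEquality using (_≡_)

record Graph (n : ℕ) : Set₁ where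
  field
    Adj    : Fin n → Fin n → Set
    adj?   : (u v : Fin n) → Dec (Adj u v)
    sym    : ∀ {u v} → Adj u v → Adj v u
    irrefl : ∀ {u} → ¬ Adj u u
open Graph public

module _ {n : ℕ} (G : Graph n) where

  -- |E(S, V \ S)| : number of edges with one endpoint in S and the other outside S.
  -- Each such edge is counted exactly once, as the ordered pair (u ∈ S, v ∉ S).
  cutSize : Subset n → ℕ
  cutSize S = sum (map (λ u → sum (map (λ v →
      if lookup S u ∧ not (lookup S v) ∧ ⌊ adj? G u v ⌋ then 1 else 0)
      (allFin n))) (allFin n))

  -- Ψ_E(G,k) > b, i.e. min { |E(S,V\S)|/|S| : 1 ≤ |S| ≤ k } > b, i.e. every
  -- ratio in the (finite, nonempty) set exceeds b (cleared of the denominator |S| ≥ 1).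
  ΨE>_ : ℕ → ℕ → Set
  ΨE>_ k b = (S : Subset n) → 1 ≤ ∣ S ∣ → ∣ S ∣ ≤ k → b * ∣ S ∣ < cutSize S

  Edge : Set
  Edge = Fin n × Fin n

  _≈E_ : Edge → Edge → Set
  (u , v) ≈E (u' , v') = (u ≡ u' × v ≡ v') ⊎ (u ≡ v' × v ≡ u')

  record State : Set where
    constructor ⟨_,_,_⟩
    field
      T       : Subset n
      makerE  : List Edge
      breakerE : List Edge
  open State public

  Claimed : State → Edge → Set
  Claimed s e = Any (λ e' → e' ≈E e) (makerE s ++ breakerE s)

  Free : State → Edge → Set
  Free s (u , v) = Adj G u v × ¬ Claimed s (u , v)

  FreeCrossingEdge : State → Set
  FreeCrossingEdge s = Σ Edge λ { (u , v) → u ∈ T s × v ∉ T s × Free s (u , v) }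

  BreakerMove : ℕ → State → State → Set
  BreakerMove b s s' =
    Σ (List Edge) λ L →
        All (Free s) L
      × AllPairs (λ e e' → ¬ e ≈E e') L
      × (length L ≡ b ⊎ (length L < b × (∀ e → Free s e → Any (λ e' → e' ≈E e) L)))
      × s' ≡ ⟨ T s , makerE s , breakerE s ++ L ⟩

  TreeMove : State → State → Set
  TreeMove s s' =
    Σ Edge λ { (u , v) → u ∈ T s × v ∉ T s × Free s (u , v)
      × s' ≡ ⟨ T s ∪ ⁅ v ⁆ , (u , v) ∷ makerE s , breakerE s ⟩ }

  -- BeforeMaker b r j s : s is a possible position immediately before Maker's j-th move
  -- (j ≥ 1) in the (1:b) game with Breaker moving first, Maker having followed the
  -- tree strategy rooted at r in all his previous moves, Breaker playing arbitrarily.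
  data BeforeMaker (b : ℕ) (r : Fin n) : ℕ → State → Set where
    first : ∀ {s} → BreakerMove b ⟨ ⁅ r ⁆ , [] , [] ⟩ s → BeforeMaker b r 1 s
    next  : ∀ {j s s' s''} → BeforeMaker b r j s → TreeMove s s' → BreakerMove b s' s''
          → BeforeMaker b r (suc j) s''

-- Before Maker's j-th move his tree T has exactly j vertices, Breaker has
-- claimed at most b·j edges, and every edge of Maker lies inside T.  Since
-- Ψ_E(G,k) > b, the cut E(T, V∖T) has more than b·|T| = b·j edges.  None of
-- them is Maker's, and each of Breaker's edges is at most one cut edge, so
-- some cut edge is still free.
module Submission where

open import Defs
open import Data.Nat using (ℕ; _≤_; _/_)
open import Data.Fin using (Fin)
open import Data.Fin.Subset using (Subset)

open import Algebra.Properties.CommutativeSemigroup as CommutativeSemigroup using ()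
open import Data.Bool using (Bool; true; false; _∧_; not; if_then_else_)
open import Data.Empty using (⊥-elim)
open import Data.Fin using (zero; suc)
open import Data.Fin.Properties using (_≟_; any?)
open import Data.Fin.Subset using (_∪_; ⁅_⁆; _∈_; _∉_; _⊆_; ∣_∣; inside; outside)
open import Data.Fin.Subset.Properties
  using (_∈?_; x∈⁅x⁆; ∣⁅x⁆∣≡1; p⊆p∪q; q⊆p∪q; ∪-identityʳ)
open import Data.List using (List; []; _∷_; _++_; length; map; allFin)
open import Data.List.Properties using (length-++; map-cong; map-tabulate)
open import Data.List.Relation.Unary.All as All using (All; []; _∷_)
open import Data.List.Relation.Unary.Any as Any using (Any; here; there)
open import Data.List.Relation.Unary.Any.Properties using (++⁻)
open import Data.Nat using (suc; _+_; _*_; _<_; z≤n)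
open import Data.Nat.ListAction using (sum)
open import Data.Nat.Properties
  using (+-comm; +-identityʳ; *-identityʳ; *-suc; +-mono-≤; ≤-refl; ≤-reflexive; ≤-trans;
         <⇒≤; <⇒≱; m≤m+n; m≤n+m; +-commutativeSemigroup; module ≤-Reasoning)
open import Data.Product using (Σ; _×_; _,_; proj₁; proj₂)
open import Data.Sum using (inj₁; inj₂)
open import Data.Vec using (lookup; _∷_)
import Data.Vec as Vec
open import Data.Vec.Properties using (lookup⇒[]=; []=⇒lookup)
open import Function using (_∘_; id)
open import Relation.Nullary using (Dec; yes; no; does)
open import Relation.Nullary.Decidable
  using (⌊_⌋; dec-true; decidable-stable; map′; _×-dec_; _⊎-dec_; ¬?)
open import Relation.Binary.PropositionalEquality as ≡
  using (_≡_; refl; trans; cong; subst; module ≡-Reasoning)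

𝟙 : Bool → ℕ
𝟙 x = if x then 1 else 0

𝟙≤1 : ∀ x → 𝟙 x ≤ 1
𝟙≤1 true  = ≤-refl
𝟙≤1 false = z≤n

∧-not-true : ∀ x y → x ∧ not y ≡ true → x ≡ true × y ≡ false
∧-not-true true  false _  = refl , refl
∧-not-true true  true  ()
∧-not-true false _     ()

𝟙-split : ∀ x y → 𝟙 x ≡ 𝟙 (x ∧ not y) + 𝟙 (y ∧ x)
𝟙-split true  true  = refl
𝟙-split true  false = refl
𝟙-split false true  = refl
𝟙-split false false = refl

module _ {A : Set} where

  sum-map-mono-≤ : {f g : A → ℕ} → (∀ x → f x ≤ g x) → ∀ xs → sum (map f xs) ≤ sum (map g xs)
  sum-map-mono-≤ f≤g []       = z≤n
  sum-map-mono-≤ f≤g (x ∷ xs) = +-mono-≤ (f≤g x) (sum-map-mono-≤ f≤g xs)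

  sum-map-+ : (f g : A → ℕ) → ∀ xs →
    sum (map (λ x → f x + g x) xs) ≡ sum (map f xs) + sum (map g xs)
  sum-map-+ f g []       = refl
  sum-map-+ f g (x ∷ xs) = trans (cong (f x + g x +_) (sum-map-+ f g xs))
    (CommutativeSemigroup.interchange +-commutativeSemigroup (f x) (g x) _ _)

  sum-map-zero : ∀ xs → sum (map (λ (_ : A) → 0) xs) ≡ 0
  sum-map-zero []       = refl
  sum-map-zero (_ ∷ xs) = sum-map-zero xs

∑ : ∀ {n} → (Fin n → ℕ) → ℕ
∑ {n} f = sum (map f (allFin n))

∑∑ : ∀ {n} → (Fin n → Fin n → ℕ) → ℕ
∑∑ f = ∑ λ u → ∑ (f u)

module _ {n : ℕ} where

  ∑-cong : {f g : Fin n → ℕ} → (∀ i → f i ≡ g i) → ∑ f ≡ ∑ g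
  ∑-cong f≗g = cong sum (map-cong f≗g (allFin n))

  ∑∑-cong : {f g : Fin n → Fin n → ℕ} → (∀ u v → f u v ≡ g u v) → ∑∑ f ≡ ∑∑ g
  ∑∑-cong f≗g = ∑-cong (λ u → ∑-cong (f≗g u))

  ∑∑-mono-≤ : {f g : Fin n → Fin n → ℕ} → (∀ u v → f u v ≤ g u v) → ∑∑ f ≤ ∑∑ g
  ∑∑-mono-≤ f≤g = sum-map-mono-≤ (λ u → sum-map-mono-≤ (f≤g u) (allFin n)) (allFin n)

  ∑∑-+ : (f g : Fin n → Fin n → ℕ) → ∑∑ (λ u v → f u v + g u v) ≡ ∑∑ f + ∑∑ g
  ∑∑-+ f g = trans (∑-cong (λ u → sum-map-+ (f u) (g u) (allFin n))) (sum-map-+ _ _ (allFin n))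

  ∑∑-zero : ∑∑ (λ (_ _ : Fin n) → 0) ≡ 0
  ∑∑-zero = trans (∑-cong (λ _ → sum-map-zero (allFin n))) (sum-map-zero (allFin n))

∑-suc : ∀ {n} (f : Fin (suc n) → ℕ) → ∑ f ≡ f zero + ∑ (f ∘ suc)
∑-suc f = cong (λ xs → f zero + sum xs)
  (trans (map-tabulate suc f) (≡.sym (map-tabulate id (f ∘ suc))))

∑-δ : ∀ {n} (a : Fin n) (x : ℕ) → ∑ (λ i → if does (i ≟ a) then x else 0) ≡ x
∑-δ {suc n} zero x = begin
  ∑ δ₀                       ≡⟨ ∑-suc δ₀ ⟩
  x + ∑ (λ (_ : Fin n) → 0)  ≡⟨ cong (x +_) (sum-map-zero (allFin n)) ⟩
  x + 0                      ≡⟨ +-identityʳ x ⟩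
  x                          ∎
  where
  open ≡-Reasoning
  δ₀ : Fin (suc n) → ℕ
  δ₀ i = if does (i ≟ zero) then x else 0
∑-δ {suc n} (suc a) x = trans (∑-suc (λ i → if does (i ≟ suc a) then x else 0)) (∑-δ a x)

pointMass : ∀ {n} → Fin n → Fin n → ℕ → Fin n → Fin n → ℕ
pointMass a b x u v = if does (u ≟ a) ∧ does (v ≟ b) then x else 0

∑∑-pointMass : ∀ {n} (a b : Fin n) (x : ℕ) → ∑∑ (pointMass a b x) ≡ x
∑∑-pointMass {n} a b x = trans (∑-cong row) (∑-δ a x)
  where
  row : ∀ u → ∑ {n} (pointMass a b x u) ≡ (if does (u ≟ a) then x else 0)
  row u with does (u ≟ a)
  ... | true  = ∑-δ b x
  ... | false = sum-map-zero (allFin n)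

∣p∪⁅x⁆∣≡1+∣p∣ : ∀ {n} {p : Subset n} {x : Fin n} → x ∉ p → ∣ p ∪ ⁅ x ⁆ ∣ ≡ suc ∣ p ∣
∣p∪⁅x⁆∣≡1+∣p∣ {p = inside  ∷ p} {zero}  x∉p = ⊥-elim (x∉p Vec.here)
∣p∪⁅x⁆∣≡1+∣p∣ {p = outside ∷ p} {zero}  x∉p = cong (suc ∘ ∣_∣) (∪-identityʳ p)
∣p∪⁅x⁆∣≡1+∣p∣ {p = inside  ∷ p} {suc x} x∉p = cong suc (∣p∪⁅x⁆∣≡1+∣p∣ (x∉p ∘ Vec.there))
∣p∪⁅x⁆∣≡1+∣p∣ {p = outside ∷ p} {suc x} x∉p = ∣p∪⁅x⁆∣≡1+∣p∣ (x∉p ∘ Vec.there)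

lookup-false⇒∉ : ∀ {n} {S : Subset n} {v} → lookup S v ≡ false → v ∉ S
lookup-false⇒∉ Sv v∈S with () ← trans (≡.sym Sv) ([]=⇒lookup v∈S)

module _ {n : ℕ} (G : Graph n) where

  _≈_ : Edge G → Edge G → Set
  _≈_ = _≈E_ G

  _≈?_ : (e e' : Edge G) → Dec (e ≈ e')
  (a , b) ≈? (a' , b') = ((a ≟ a') ×-dec (b ≟ b')) ⊎-dec ((a ≟ b') ×-dec (b ≟ a'))

  Covers : List (Edge G) → Edge G → Set
  Covers L e = Any (_≈ e) L

  covers : Edge G → Fin n → Fin n → Bool
  covers e u v = does (e ≈? (u , v))

  Asymmetric : (Fin n → Fin n → Bool) → Set
  Asymmetric d = ∀ {u v} → d u v ≡ true → d v u ≡ false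

  𝟙-asym : ∀ d → Asymmetric d → ∀ u v → 𝟙 (d u v) + 𝟙 (d v u) ≤ 1
  𝟙-asym d asym u v with d u v in uv
  ... | false = 𝟙≤1 (d v u)
  ... | true rewrite asym uv = ≤-refl

  𝟙-covers-≤ : (d : Fin n → Fin n → Bool) (a b : Fin n) {u v : Fin n}
    (ab≈?uv : Dec ((a , b) ≈ (u , v))) →
    𝟙 (does ab≈?uv ∧ d u v) ≤ pointMass a b (𝟙 (d a b)) u v + pointMass b a (𝟙 (d b a)) u v
  𝟙-covers-≤ d a b (no _) = z≤n
  𝟙-covers-≤ d a b (yes (inj₁ (refl , refl)))
    rewrite dec-true (a ≟ a) refl | dec-true (b ≟ b) refl = m≤m+n _ _
  𝟙-covers-≤ d a b (yes (inj₂ (refl , refl)))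
    rewrite dec-true (a ≟ a) refl | dec-true (b ≟ b) refl = m≤n+m _ _

  -- An edge covers both orientations of itself, so it is asymmetry of d that
  -- lets it account for at most one point of d.
  covered-by-one-≤1 : ∀ d → Asymmetric d → ∀ e →
    ∑∑ (λ u v → 𝟙 (covers e u v ∧ d u v)) ≤ 1
  covered-by-one-≤1 d asym (a , b) = begin
    ∑∑ (λ u v → 𝟙 (covers (a , b) u v ∧ d u v))
      ≤⟨ ∑∑-mono-≤ (λ u v → 𝟙-covers-≤ d a b ((a , b) ≈? (u , v))) ⟩
    ∑∑ (λ u v → pointMass a b (𝟙 (d a b)) u v + pointMass b a (𝟙 (d b a)) u v)
      ≡⟨ ∑∑-+ (pointMass a b (𝟙 (d a b))) (pointMass b a (𝟙 (d b a))) ⟩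
    ∑∑ (pointMass a b (𝟙 (d a b))) + ∑∑ (pointMass b a (𝟙 (d b a)))
      ≡⟨ ≡.cong₂ _+_ (∑∑-pointMass a b _) (∑∑-pointMass b a _) ⟩
    𝟙 (d a b) + 𝟙 (d b a)
      ≤⟨ 𝟙-asym d asym a b ⟩
    1 ∎
    where open ≤-Reasoning

  Covers-tail : ∀ {e L u v} (e≈?uv : Dec (e ≈ (u , v))) → does e≈?uv ≡ false →
    Covers (e ∷ L) (u , v) → Covers L (u , v)
  Covers-tail (yes _)   ()
  Covers-tail (no e≉uv) _ (here e≈uv)  = ⊥-elim (e≉uv e≈uv)
  Covers-tail (no _)    _ (there L∋uv) = L∋uv

  count-covered-≤ : (d : Fin n → Fin n → Bool) → Asymmetric d → (L : List (Edge G)) →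
    (∀ {u v} → d u v ≡ true → Covers L (u , v)) → ∑∑ (λ u v → 𝟙 (d u v)) ≤ length L
  count-covered-≤ d asym [] covered = begin
    ∑∑ (λ u v → 𝟙 (d u v))  ≤⟨ ∑∑-mono-≤ nothing-in-d ⟩
    ∑∑ {n} (λ _ _ → 0)      ≡⟨ ∑∑-zero {n} ⟩
    0                       ∎
    where
    open ≤-Reasoning
    nothing-in-d : ∀ u v → 𝟙 (d u v) ≤ 0
    nothing-in-d u v with d u v in uv
    ... | false = z≤n
    ... | true with () ← covered uv
  count-covered-≤ d asym (e ∷ L) covered = begin
    ∑∑ (λ u v → 𝟙 (d u v))
      ≡⟨ ∑∑-cong (λ u v → 𝟙-split (d u v) (covers e u v)) ⟩
    ∑∑ (λ u v → 𝟙 (d′ u v) + 𝟙 (covers e u v ∧ d u v))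
      ≡⟨ ∑∑-+ (λ u v → 𝟙 (d′ u v)) (λ u v → 𝟙 (covers e u v ∧ d u v)) ⟩
    ∑∑ (λ u v → 𝟙 (d′ u v)) + ∑∑ (λ u v → 𝟙 (covers e u v ∧ d u v))
      ≤⟨ +-mono-≤ (count-covered-≤ d′ asym′ L covered′) (covered-by-one-≤1 d asym e) ⟩
    length L + 1
      ≡⟨ +-comm (length L) 1 ⟩
    suc (length L) ∎
    where
    open ≤-Reasoning
    d′ : Fin n → Fin n → Bool
    d′ u v = d u v ∧ not (covers e u v)
    asym′ : Asymmetric d′
    asym′ uv∈d′ rewrite asym (proj₁ (∧-not-true _ _ uv∈d′)) = refl
    covered′ : ∀ {u v} → d′ u v ≡ true → Covers L (u , v)
    covered′ {u} {v} uv∈d′ with ∧-not-true _ _ uv∈d′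
    ... | uv∈d , e≉uv = Covers-tail (e ≈? (u , v)) e≉uv (covered uv∈d)

  -- cutSize G S unfolds to ∑∑ (λ u v → 𝟙 (cut S u v)).
  cut : Subset n → Fin n → Fin n → Bool
  cut S u v = lookup S u ∧ not (lookup S v) ∧ ⌊ adj? G u v ⌋

  cut-true : ∀ {S u v} → cut S u v ≡ true → u ∈ S × v ∉ S × Adj G u v
  cut-true {S} {u} {v} uv∈cut with lookup S u in Su | lookup S v in Sv | adj? G u v
  ... | true | false | yes uv∈E =
    lookup⇒[]= u S Su , lookup-false⇒∉ Sv , uv∈E
  cut-true () | true  | true  | _
  cut-true () | true  | false | no _
  cut-true () | false | _     | _

  cut-asym : ∀ {S} → Asymmetric (cut S)
  cut-asym {S} {u} {v} uv∈cut with lookup S u | lookup S v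
  ... | true  | false = refl
  cut-asym () | true  | true
  cut-asym () | false | _

  Inside : Subset n → Edge G → Set
  Inside S (u , v) = u ∈ S × v ∈ S

  Inside-⊆ : ∀ {S S′} → S ⊆ S′ → ∀ {e} → Inside S e → Inside S′ e
  Inside-⊆ S⊆S′ (u∈S , v∈S) = S⊆S′ u∈S , S⊆S′ v∈S

  Covers-Inside : ∀ {S L e} → All (Inside S) L → Covers L e → Inside S e
  Covers-Inside ((a∈S , b∈S) ∷ _) (here (inj₁ (refl , refl))) = a∈S , b∈S
  Covers-Inside ((a∈S , b∈S) ∷ _) (here (inj₂ (refl , refl))) = b∈S , a∈S
  Covers-Inside (_ ∷ L⊆S)         (there L∋e)                  = Covers-Inside L⊆S L∋e

  breakerMove-appends : ∀ {b s s′} → BreakerMove G b s s′ →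
    Σ (List (Edge G)) λ L → length L ≤ b × s′ ≡ ⟨ T s , makerE s , breakerE s ++ L ⟩
  breakerMove-appends (L , _ , _ , inj₁ |L|≡b , refl)       = L , ≤-reflexive |L|≡b , refl
  breakerMove-appends (L , _ , _ , inj₂ (|L|<b , _) , refl) = L , <⇒≤ |L|<b , refl

  module _ {b : ℕ} {r : Fin n} where

    tree-size : ∀ {j s} → BeforeMaker G b r j s → ∣ T s ∣ ≡ j
    tree-size (first move) with breakerMove-appends move
    ... | _ , _ , refl = ∣⁅x⁆∣≡1 r
    tree-size (next play ((_ , v) , _ , v∉T , _ , refl) move) with breakerMove-appends move
    ... | _ , _ , refl = trans (∣p∪⁅x⁆∣≡1+∣p∣ v∉T) (cong suc (tree-size play))

    breaker-edges-≤ : ∀ {j s} → BeforeMaker G b r j s → length (breakerE s) ≤ b * j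
    breaker-edges-≤ (first move) with breakerMove-appends move
    ... | _ , |L|≤b , refl = ≤-trans |L|≤b (≤-reflexive (≡.sym (*-identityʳ b)))
    breaker-edges-≤ {suc j} (next {s = s} play (_ , _ , _ , _ , refl) move)
      with breakerMove-appends move
    ... | L , |L|≤b , refl = begin
      length (breakerE s ++ L)        ≡⟨ length-++ (breakerE s) ⟩
      length (breakerE s) + length L  ≤⟨ +-mono-≤ (breaker-edges-≤ play) |L|≤b ⟩
      b * j + b                       ≡⟨ +-comm (b * j) b ⟩
      b + b * j                       ≡⟨ *-suc b j ⟨
      b * suc j                       ∎
      where open ≤-Reasoning

    maker-edges-inside : ∀ {j s} → BeforeMaker G b r j s → All (Inside (T s)) (makerE s)
    maker-edges-inside (first move) with breakerMove-appends move
    ... | _ , _ , refl = []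
    maker-edges-inside (next {s = s} play ((_ , v) , u∈T , _ , _ , refl) move)
      with breakerMove-appends move
    ... | _ , _ , refl =
      (p⊆p∪q ⁅ v ⁆ u∈T , q⊆p∪q (T s) ⁅ v ⁆ (x∈⁅x⁆ v))
        ∷ All.map (Inside-⊆ (p⊆p∪q ⁅ v ⁆)) (maker-edges-inside play)

  claimed? : ∀ s e → Dec (Claimed G s e)
  claimed? s e = Any.any? (_≈? e) (makerE s ++ breakerE s)

  freeCrossingEdge? : ∀ s → Dec (FreeCrossingEdge G s)
  freeCrossingEdge? s = map′ (λ (u , v , uv) → (u , v) , uv) (λ ((u , v) , uv) → u , v , uv)
    (any? λ u → any? λ v →
      (u ∈? T s) ×-dec ¬? (v ∈? T s) ×-dec adj? G u v ×-dec ¬? (claimed? s (u , v)))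

  freeCrossingEdge : ∀ s → All (Inside (T s)) (makerE s) →
    length (breakerE s) < cutSize G (T s) → FreeCrossingEdge G s
  freeCrossingEdge s maker⊆T |B|<cut with freeCrossingEdge? s
  ... | yes uv = uv
  ... | no ∄uv = ⊥-elim (<⇒≱ |B|<cut
          (count-covered-≤ (cut (T s)) (cut-asym {T s}) (breakerE s) claimed-by-breaker))
    where
    claimed-by-breaker : ∀ {u v} → cut (T s) u v ≡ true → Covers (breakerE s) (u , v)
    claimed-by-breaker {u} {v} uv∈cut with cut-true uv∈cut
    ... | u∈T , v∉T , uv∈E with ++⁻ (makerE s) (decidable-stable (claimed? s (u , v))
                                   λ unclaimed → ∄uv ((u , v) , u∈T , v∉T , uv∈E , unclaimed))
    ...   | inj₁ maker∋uv   = ⊥-elim (v∉T (proj₂ (Covers-Inside maker⊆T maker∋uv)))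
    ...   | inj₂ breaker∋uv = breaker∋uv

proposition2p1 : (n : ℕ) (G : Graph n) (b k : ℕ) → 1 ≤ b → 1 ≤ k → k ≤ n / 2
    → ΨE>_ G k b
    → (r : Fin n) (j : ℕ) (s : State G) → 1 ≤ j → j ≤ k
    → BeforeMaker G b r j s → FreeCrossingEdge G s
proposition2p1 n G b k _ _ _ Ψ>b r j s 1≤j j≤k play =
  freeCrossingEdge G s (maker-edges-inside G play) (begin-strict
    length (breakerE s)  ≤⟨ breaker-edges-≤ G play ⟩
    b * j                ≡⟨ cong (b *_) |T|≡j ⟨
    b * ∣ T s ∣          <⟨ Ψ>b (T s) (subst (1 ≤_) (≡.sym |T|≡j) 1≤j) (subst (_≤ k) (≡.sym |T|≡j) j≤k) ⟩
    cutSize G (T s)      ∎)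
  where
  open ≤-Reasoning
  |T|≡j : ∣ T s ∣ ≡ j
  |T|≡j = tree-size G play
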